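{- If $G$ is an $n$-vertex $2$-tree ($n\ge 2$) with exactly two simplicial vertices, then the number of spanning trees of $G$ equals the Fibonacci number $F_{2n-2}$. In particular this number is asymptotic to $\frac{1}{\sqrt5}\left(\frac{1+\sqrt5}{2}\right)^{2n-2}$ as $n\to\infty$.
   Context: A $2$-tree is a graph obtained from the graph consisting of two adjacent vertices by iteratively adding one new vertex whose neighborhood consists of two adjacent vertices. A vertex is simplicial if its neighborhood is a clique (set of pairwise adjacent vertices). The Fibonacci sequence is $F_0=0$, $F_1=1$, $F_m=F_{m-1}+F_{m-2}$ for $m\ge 2$. -}

module Defs where

open import Data.Nat using (ℕ; zero; suc; _+_; _∸_)
open import Data.Fin using (Fin; zero; suc; _≟_; _<_)
open import Data.Bool using (Bool; true; false; not; _∨_)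
open import Data.Vec using (Vec; lookup)
open import Data.List using (List; length)
open import Data.List.Membership.Propositional using (_∈_)
open import Data.List.Relation.Unary.Unique.Propositional using (Unique)
open import Data.Product using (Σ; _×_; proj₁; proj₂)
open import Function.Bundles using (_⇔_; _↔_; Inverse)
open import Relation.Nullary.Decidable using (⌊_⌋)
open import Relation.Binary.PropositionalEquality using (_≡_; _≢_)

fib : ℕ → ℕ
fib zero = zero
fib (suc zero) = suc zero
fib (suc (suc m)) = fib (suc m) + fib m

-- "exactly k elements of A satisfy P": there is a duplicate-free list of
-- length k whose members are exactly the elements satisfying P.
HasCount : {A : Set} → (A → Set) → ℕ → Set
HasCount {A} P k =
  Σ (List A) λ xs → Unique xs × length xs ≡ k × (∀ x → P x ⇔ (x ∈ xs))

Graph : ℕ → Set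
Graph n = Fin n → Fin n → Bool

K₂ : Graph 2
K₂ i j = not ⌊ i ≟ j ⌋

-- Add a new vertex (labelled zero; old vertices are shifted by suc)
-- whose neighbourhood is exactly {a, b}.
extend : ∀ {n} → Graph n → Fin n → Fin n → Graph (suc n)
extend G a b zero zero = false
extend G a b zero (suc j) = ⌊ j ≟ a ⌋ ∨ ⌊ j ≟ b ⌋
extend G a b (suc i) zero = ⌊ i ≟ a ⌋ ∨ ⌊ i ≟ b ⌋
extend G a b (suc i) (suc j) = G i j

relabel : ∀ {n} → (Fin n ↔ Fin n) → Graph n → Graph n
relabel π G i j = G (Inverse.to π i) (Inverse.to π j)

data TwoTree : (n : ℕ) → Graph n → Set where
  base    : TwoTree 2 K₂
  add     : ∀ {n G} (a b : Fin n) → G a b ≡ true → TwoTree n G →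
            TwoTree (suc n) (extend G a b)
  iso     : ∀ {n G} (π : Fin n ↔ Fin n) → TwoTree n G → TwoTree n (relabel π G)

Simplicial : ∀ {n} → Graph n → Fin n → Set
Simplicial G v = ∀ u w → G v u ≡ true → G v w ≡ true → u ≢ w → G u w ≡ true

-- Spanning subgraphs are given by adjacency matrices (first-order data).
Matrix : ℕ → Set
Matrix n = Vec (Vec Bool n) n

entry : ∀ {n} → Matrix n → Fin n → Fin n → Bool
entry M i j = lookup (lookup M i) j

data Walk {n} (T : Matrix n) : Fin n → Fin n → Set where
  here : ∀ {u} → Walk T u u
  step : ∀ {u w v} → entry T u w ≡ true → Walk T w v → Walk T u v

Connected : ∀ {n} → Matrix n → Set
Connected T = ∀ u v → Walk T u v

-- an edge {i,j} of T, recorded once as the ordered pair with i < j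
IsEdge : ∀ {n} → Matrix n → Fin n × Fin n → Set
IsEdge T p = proj₁ p < proj₂ p × entry T (proj₁ p) (proj₂ p) ≡ true

IsSpanningTree : ∀ {n} → Graph n → Matrix n → Set
IsSpanningTree {n} G T =
  (∀ i j → entry T i j ≡ entry T j i) ×
  (∀ i → entry T i i ≡ false) ×
  (∀ i j → entry T i j ≡ true → G i j ≡ true) ×
  Connected T ×
  HasCount (IsEdge T) (n ∸ 1)

{-# OPTIONS --safe #-}
-- Up to relabelling, every 2-tree is an edge, a triangle, a graph with three pairwise
-- non-adjacent simplicial vertices, or a two-path: a core with one vertex attached on each of
-- two of its edges, such that a vertex added next to one of these two ends gives a two-path
-- again and a vertex added anywhere else gives three non-adjacent simplicial vertices (Shape).
-- Three simplicial vertices survive every extension, so with exactly two simplicial vertices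
-- only the edge and the two-paths remain.
--
-- The spanning trees of a graph G with a new vertex v on the edge ab are classified by which
-- of the edges va, vb they use: t(G + v) = 2 t(G) + f(G; a, b), where f counts the spanning
-- forests with two trees separating a and b, and f(G + v; v, a) = t(G) + f(G; a, b).  Growing
-- a two-path at an end turns these into F(2j + 4) = 3 F(2j + 2) - F(2j), so t = F(2n - 2).
module Submission where

open import Defs
open import Data.Nat using (ℕ; zero; suc; _+_; _*_; _∸_; _≤_; z≤n; s≤s; s≤s⁻¹)
open import Data.Nat.Properties
  using ( ≤-antisym; ≤-trans; ≤-reflexive; suc-injective; +-suc; +-comm; +-assoc; +-cancelˡ-≡; *-suc
        ; +-monoʳ-≤; m≤n⇒m≤1+n; <-irrefl; module ≤-Reasoning)
open import Data.Nat.Tactic.RingSolver using (solve-∀)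
open import Data.Bool using (Bool; true; false; not; _∨_; _∧_; if_then_else_)
import Data.Bool.Properties as Bool
open import Data.Fin using (Fin; zero; suc; _≟_; _<_)
open import Data.Fin.Properties using (all?; <-cmp; <-asym)
import Data.Fin.Properties as Fin
open import Data.Fin.Patterns using (0F; 1F; 2F)
open import Data.Fin.Permutation
  using (Permutation′; _⟨$⟩ʳ_; _⟨$⟩ˡ_; inverseˡ; inverseʳ; id; flip; _∘ₚ_; lift₀; transpose)
open import Data.Vec using (tabulate; lookup)
open import Data.Vec.Properties using (lookup∘tabulate; tabulate∘lookup; tabulate-cong)
import Data.Vec.Properties as Vec
open import Data.List using (List; []; _∷_; _++_; map; length; filter; allFin)
open import Data.List.Properties using (length-++; length-map; length-++-sucʳ; map-∘; map-id-local)
open import Data.List.Membership.Propositional using (_∈_)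
open import Data.List.Membership.Propositional.Properties
  using (∈-∃++; ∈-++⁺ˡ; ∈-++⁺ʳ; ∈-++⁻; ∈-map⁺; ∈-map⁻; ∈-filter⁺; ∈-filter⁻; ∈-allFin)
open import Data.List.Relation.Unary.Any using (here; there)
open import Data.List.Relation.Unary.All as All using (All; []; _∷_)
open import Data.List.Relation.Unary.AllPairs using ([]; _∷_)
open import Data.List.Relation.Unary.Unique.Propositional using (Unique)
import Data.List.Relation.Unary.Unique.Propositional.Properties as Unique
open import Data.Product using (Σ-syntax; ∃-syntax; _×_; _,_; proj₁; proj₂; uncurry)
import Data.Product as Product
open import Data.Sum using (_⊎_; inj₁; inj₂; [_,_])
import Data.Sum as Sum
open import Data.Empty using (⊥; ⊥-elim)
open import Function using (_∘_; _⇔_; mk⇔; Equivalence; _↔_; Inverse; mk↔ₛ′)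
open import Function.Construct.Composition using (_⇔-∘_)
open import Function.Construct.Symmetry using (⇔-sym)
open import Relation.Nullary using (¬_; Dec; yes; no; contradiction)
open import Relation.Nullary.Decidable using (⌊_⌋; ⌊⌋-map′; isYes≗does; dec-true; dec-false; from-yes; toWitness)
open import Relation.Unary using (Decidable)
open import Relation.Binary.Definitions using (DecidableEquality; tri<; tri≈; tri>)
open import Relation.Binary.Construct.Closure.ReflexiveTransitive using (Star; ε; _◅_; _◅◅_; gmap; reverse)
open import Relation.Binary.PropositionalEquality hiding ([_])

private variable
  A B : Set
  P Q : A → Set
  k l m n : ℕ
  a b s u v w : Fin n
  E E′ G G′ H K : Graph n
  T : Matrix n
  N N′ : Fin n → Bool

-- Counting

private
  module ⇔ {a b} {X : Set a} {Y : Set b} (e : X ⇔ Y) = Equivalence e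

Unique-⊆⇒length≤ : {xs ys : List A} → Unique xs → (∀ {x} → x ∈ xs → x ∈ ys) → length xs ≤ length ys
Unique-⊆⇒length≤ [] _ = z≤n
Unique-⊆⇒length≤ {xs = x ∷ xs} (x∉xs ∷ u) xs⊆ys with ∈-∃++ (xs⊆ys (here refl))
... | ys₁ , ys₂ , refl =
  ≤-trans (s≤s (Unique-⊆⇒length≤ u xs⊆ys₁ys₂)) (≤-reflexive (sym (length-++-sucʳ ys₁ x ys₂)))
  where
  xs⊆ys₁ys₂ : ∀ {y} → y ∈ xs → y ∈ ys₁ ++ ys₂
  xs⊆ys₁ys₂ y∈xs with ∈-++⁻ ys₁ (xs⊆ys (there y∈xs))
  ... | inj₁ y∈ys₁ = ∈-++⁺ˡ y∈ys₁
  ... | inj₂ (here refl) = ⊥-elim (All.lookup x∉xs y∈xs refl)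
  ... | inj₂ (there y∈ys₂) = ∈-++⁺ʳ ys₁ y∈ys₂

HasCount-length≤ : HasCount P k → {xs : List A} → Unique xs → All P xs → length xs ≤ k
HasCount-length≤ (ys , _ , refl , P⇔) u Pxs =
  Unique-⊆⇒length≤ u (λ x∈xs → ⇔.to (P⇔ _) (All.lookup Pxs x∈xs))

HasCount₂-three : HasCount P 2 → ∀ {x y z} → P x → P y → P z → x ≢ y → x ≢ z → y ≢ z → ⊥
HasCount₂-three count Px Py Pz x≢y x≢z y≢z
  with HasCount-length≤ count ((x≢y ∷ x≢z ∷ []) ∷ (y≢z ∷ []) ∷ [] ∷ []) (Px ∷ Py ∷ Pz ∷ [])
... | s≤s (s≤s ())

HasCount-unique : HasCount P k → HasCount P l → k ≡ l
HasCount-unique c@(xs , u , refl , P⇔) c′@(ys , v , refl , P⇔′) =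
  ≤-antisym (HasCount-length≤ c′ u (All.tabulate (⇔.from (P⇔ _))))
            (HasCount-length≤ c v (All.tabulate (⇔.from (P⇔′ _))))

HasCount-⇔ : (∀ x → P x ⇔ Q x) → HasCount P k → HasCount Q k
HasCount-⇔ P⇔Q (xs , u , len , P⇔) =
  xs , u , len , λ x → mk⇔ (⇔.to (P⇔ x) ∘ ⇔.from (P⇔Q x)) (⇔.to (P⇔Q x) ∘ ⇔.from (P⇔ x))

HasCount-∅ : (∀ x → ¬ P x) → HasCount P 0
HasCount-∅ ¬P = [] , [] , refl , λ x → mk⇔ (⊥-elim ∘ ¬P x) λ ()

HasCount-≡ : (y : A) → HasCount (_≡ y) 1
HasCount-≡ y = y ∷ [] , [] ∷ [] , refl , λ x → mk⇔ here λ { (here x≡y) → x≡y }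

HasCount-singleton : {y : A} → P y → (∀ {x} → P x → x ≡ y) → HasCount P 1
HasCount-singleton {y = y} Py unique = HasCount-⇔ (λ x → mk⇔ (λ { refl → Py }) unique) (HasCount-≡ y)

HasCount-filter : {P : A → Set} (P? : Decidable P) {xs : List A} → Unique xs → (∀ {x} → P x → x ∈ xs) →
                  HasCount P (length (filter P? xs))
HasCount-filter P? {xs} u P⊆xs =
  filter P? xs , Unique.filter⁺ P? u , refl ,
  λ x → mk⇔ (λ Px → ∈-filter⁺ P? (P⊆xs Px) Px) (proj₂ ∘ ∈-filter⁻ P? {xs = xs})

HasCount-⊎ : HasCount P k → HasCount Q l → (∀ x → P x → Q x → ⊥) → HasCount (λ x → P x ⊎ Q x) (k + l)
HasCount-⊎ (xs , u , refl , P⇔) (ys , v , refl , Q⇔) disjoint =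
  xs ++ ys , Unique.++⁺ u v (λ (x∈xs , x∈ys) → disjoint _ (⇔.from (P⇔ _) x∈xs) (⇔.from (Q⇔ _) x∈ys)) ,
  length-++ xs ,
  λ x → mk⇔ [ ∈-++⁺ˡ ∘ ⇔.to (P⇔ x) , ∈-++⁺ʳ xs ∘ ⇔.to (Q⇔ x) ]
            (Sum.map (⇔.from (P⇔ x)) (⇔.from (Q⇔ x)) ∘ ∈-++⁻ xs)

Image : (A → B) → (A → Set) → B → Set
Image {A} f P y = Σ[ x ∈ A ] P x × f x ≡ y

HasCount-image : (f : A → B) → (∀ {x y} → f x ≡ f y → x ≡ y) → HasCount P k → HasCount (Image f P) k
HasCount-image f f-inj (xs , u , refl , P⇔) =
  map f xs , Unique.map⁺ f-inj u , length-map f xs ,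
  λ y → mk⇔ (λ { (x , Px , refl) → ∈-map⁺ f (⇔.to (P⇔ x) Px) })
            (λ y∈ → let (x , x∈xs , y≡fx) = ∈-map⁻ f y∈ in x , ⇔.from (P⇔ x) x∈xs , sym y≡fx)

HasCount-↔ : (f : A ↔ B) → (∀ x → P x ⇔ Q (Inverse.to f x)) → HasCount P k → HasCount Q k
HasCount-↔ {Q = Q} f P⇔Qf =
  HasCount-⇔ (λ y → mk⇔ (λ { (x , Px , refl) → ⇔.to (P⇔Qf x) Px })
                        (λ Qy → Inverse.from f y , ⇔.from (P⇔Qf _) (subst Q (sym (Inverse.strictlyInverseˡ f y)) Qy) ,
                                Inverse.strictlyInverseˡ f y))
  ∘ HasCount-image (Inverse.to f) to-injective
  where
  to-injective : ∀ {x y} → Inverse.to f x ≡ Inverse.to f y → x ≡ y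
  to-injective {x} {y} fx≡fy =
    trans (sym (Inverse.strictlyInverseʳ f x)) (trans (cong (Inverse.from f) fx≡fy) (Inverse.strictlyInverseʳ f y))

HasCount-Bool : {P : Bool → A → Set} → HasCount (P true) k → HasCount (P false) l → HasCount (uncurry P) (k + l)
HasCount-Bool {P = P} c₁ c₂ =
  HasCount-⇔ (λ { (p , x) → mk⇔ (λ { (inj₁ (x , Px , refl)) → Px ; (inj₂ (x , Px , refl)) → Px })
                                (λ Ppx → from p x Ppx) })
    (HasCount-⊎ (HasCount-image (true ,_) (λ { refl → refl }) c₁)
                (HasCount-image (false ,_) (λ { refl → refl }) c₂)
                (λ { _ (_ , _ , refl) (_ , _ , ()) }))
  where
  from : ∀ p x → P p x → Image (true ,_) (P true) (p , x) ⊎ Image (false ,_) (P false) (p , x)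
  from true x Px = inj₁ (x , Px , refl)
  from false x Px = inj₂ (x , Px , refl)

HasCount-preimage : HasCount P k → (h : B → A) (r : A → B) → (∀ x → r (h x) ≡ x) → DecidableEquality A →
                    ∃[ l ] HasCount (P ∘ h) l
HasCount-preimage {P = P} (ys , u , _ , P⇔) h r r∘h _≟ᴬ_ =
  length xs , xs , Unique.map⁻ (subst Unique (sym h∘r≡id) (Unique.filter⁺ fixed? u)) , refl ,
  λ x → mk⇔ (to x) (from x)
  where
  fixed? : Decidable (λ y → h (r y) ≡ y)
  fixed? y = h (r y) ≟ᴬ y
  zs = filter fixed? ys
  xs = map r zs
  h∘r≡id : map h xs ≡ zs
  h∘r≡id = trans (sym (map-∘ zs)) (map-id-local (All.tabulate (proj₂ ∘ ∈-filter⁻ fixed? {xs = ys})))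
  to : ∀ x → P (h x) → x ∈ xs
  to x Phx = subst (_∈ xs) (r∘h x) (∈-map⁺ r (∈-filter⁺ fixed? (⇔.to (P⇔ _) Phx) (cong h (r∘h x))))
  from : ∀ x → x ∈ xs → P (h x)
  from x x∈xs with ∈-map⁻ r x∈xs
  ... | y , y∈zs , refl with ∈-filter⁻ fixed? {xs = ys} y∈zs
  ...   | y∈ys , hry≡y = subst P (sym hry≡y) (⇔.from (P⇔ y) y∈ys)

⌊≟⌋-refl : (i : Fin n) → ⌊ i ≟ i ⌋ ≡ true
⌊≟⌋-refl i = trans (isYes≗does (i ≟ i)) (dec-true (i ≟ i) refl)

⌊≟⌋-≢ : {i j : Fin n} → i ≢ j → ⌊ i ≟ j ⌋ ≡ false
⌊≟⌋-≢ {i = i} {j} i≢j = trans (isYes≗does (i ≟ j)) (dec-false (i ≟ j) i≢j)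

⌊≟⌋-true : {i j : Fin n} → ⌊ i ≟ j ⌋ ≡ true → i ≡ j
⌊≟⌋-true e = toWitness (Equivalence.from Bool.T-≡ e)

⌊suc≟suc⌋ : (i j : Fin n) → ⌊ suc i ≟ suc j ⌋ ≡ ⌊ i ≟ j ⌋
⌊suc≟suc⌋ i j = ⌊⌋-map′ _ _ (i ≟ j)

⌊≟⌋-∨-≢ : {s a b : Fin n} → s ≢ a → s ≢ b → ⌊ s ≟ a ⌋ ∨ ⌊ s ≟ b ⌋ ≡ false
⌊≟⌋-∨-≢ s≢a s≢b = cong₂ _∨_ (⌊≟⌋-≢ s≢a) (⌊≟⌋-≢ s≢b)

∨-true : {x y : Bool} → x ∨ y ≡ true → x ≡ true ⊎ y ≡ true
∨-true {true} _ = inj₁ refl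
∨-true {false} y≡true = inj₂ y≡true

infix 4 _≐_
_≐_ : Graph n → Graph n → Set
G ≐ H = ∀ i j → G i j ≡ H i j

Symmetric : Graph n → Set
Symmetric E = ∀ i j → E i j ≡ E j i

Irreflexive : Graph n → Set
Irreflexive E = ∀ i → E i i ≡ false

delete₀ : Graph (suc n) → Graph n
delete₀ E i j = E (suc i) (suc j)

row₀ : Graph (suc n) → Fin n → Bool
row₀ E j = E zero (suc j)

attach : Graph n → (Fin n → Bool) → Graph (suc n)
attach E N zero    zero    = false
attach E N zero    (suc j) = N j
attach E N (suc i) zero    = N i
attach E N (suc i) (suc j) = E i j

attach-symmetric : Symmetric E → Symmetric (attach E N)
attach-symmetric E-sym zero    zero    = refl
attach-symmetric E-sym zero    (suc j) = refl
attach-symmetric E-sym (suc i) zero    = refl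
attach-symmetric E-sym (suc i) (suc j) = E-sym i j

attach-irreflexive : Irreflexive E → Irreflexive (attach E N)
attach-irreflexive irr zero    = refl
attach-irreflexive irr (suc i) = irr i

attach-η : Symmetric E → Irreflexive E → E ≐ attach (delete₀ E) (row₀ E)
attach-η E-sym irr zero    zero    = irr zero
attach-η E-sym irr zero    (suc j) = refl
attach-η E-sym irr (suc i) zero    = E-sym (suc i) zero
attach-η E-sym irr (suc i) (suc j) = refl

Adj : Graph n → Fin n → Fin n → Set
Adj E u v = E u v ≡ true

infix 4 _∋_⇝_
_∋_⇝_ : Graph n → Fin n → Fin n → Set
E ∋ u ⇝ v = Star (Adj E) u v

IsConnected : Graph n → Set
IsConnected E = ∀ u v → E ∋ u ⇝ v

⇝-reverse : Symmetric E → E ∋ u ⇝ v → E ∋ v ⇝ u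
⇝-reverse {E = E} E-sym = reverse (λ {u} {v} e → trans (E-sym v u) e)

⇝-resp : E ≐ E′ → E ∋ u ⇝ v → E′ ∋ u ⇝ v
⇝-resp E≐E′ = gmap (λ x → x) (λ {u} {v} e → trans (sym (E≐E′ u v)) e)

⇝-suc : delete₀ E ∋ u ⇝ v → E ∋ suc u ⇝ suc v
⇝-suc = gmap suc (λ e → e)

IsConnected-via : Symmetric E → (∀ u → E ∋ u ⇝ v) → IsConnected E
IsConnected-via E-sym to-v u w = to-v u ◅◅ ⇝-reverse E-sym (to-v w)

Reaches₀ : Graph (suc n) → Fin n → Set
Reaches₀ E u = ∃[ c ] row₀ E c ≡ true × delete₀ E ∋ u ⇝ c

Avoids₀ : Graph (suc n) → Fin n → Fin (suc n) → Set
Avoids₀ E u zero    = ⊥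
Avoids₀ E u (suc v) = delete₀ E ∋ u ⇝ v

◅-Avoids₀ : Adj E (suc u) (suc w) → Avoids₀ E w v → Avoids₀ E u v
◅-Avoids₀ {v = suc _} e q = e ◅ q

⇝-split₀ : Symmetric E → E ∋ suc u ⇝ v → Avoids₀ E u v ⊎ Reaches₀ E u
⇝-split₀ E-sym ε = inj₁ ε
⇝-split₀ {u = u} E-sym (_◅_ {j = zero} e _) = inj₂ (u , trans (E-sym zero (suc u)) e , ε)
⇝-split₀ E-sym (_◅_ {j = suc w} e p) with ⇝-split₀ E-sym p
... | inj₁ q               = inj₁ (◅-Avoids₀ e q)
... | inj₂ (c , c~0 , q) = inj₂ (c , c~0 , e ◅ q)

⇝zero⇒Reaches₀ : Symmetric E → E ∋ suc u ⇝ zero → Reaches₀ E u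
⇝zero⇒Reaches₀ E-sym = [ ⊥-elim , (λ r → r) ] ∘ ⇝-split₀ E-sym

neighbours₀ : Graph (suc n) → List (Fin n)
neighbours₀ E = filter (λ j → row₀ E j Bool.≟ true) (allFin _)

neighbours₀-count : (E : Graph (suc n)) → HasCount (λ j → row₀ E j ≡ true) (length (neighbours₀ E))
neighbours₀-count E = HasCount-filter (λ j → row₀ E j Bool.≟ true) (Unique.allFin⁺ _) (λ _ → ∈-allFin _)

∈-neighbours₀ : row₀ E v ≡ true → v ∈ neighbours₀ E
∈-neighbours₀ {E = E} = ⇔.to (proj₂ (proj₂ (proj₂ (neighbours₀-count E))) _)

edgeCount : Graph n → ℕ
edgeCount {zero}  E = 0
edgeCount {suc n} E = length (neighbours₀ E) + edgeCount (delete₀ E)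

EdgeOf : Graph n → Fin n × Fin n → Set
EdgeOf E (i , j) = i < j × E i j ≡ true

edgeCount-count : (E : Graph n) → HasCount (EdgeOf E) (edgeCount E)
edgeCount-count {zero} E = HasCount-∅ λ { (() , _) }
edgeCount-count {suc n} E =
  HasCount-⇔ classify
    (HasCount-⊎ (HasCount-image (λ j → zero , suc j) (λ { refl → refl }) (neighbours₀-count E))
                (HasCount-image (Product.map suc suc) (λ { refl → refl }) (edgeCount-count (delete₀ E)))
                (λ { _ (_ , _ , refl) ((_ , _) , _ , ()) }))
  where
  Parts : Fin (suc n) × Fin (suc n) → Set
  Parts p = Image (λ j → zero , suc j) (λ j → row₀ E j ≡ true) p
          ⊎ Image (Product.map suc suc) (EdgeOf (delete₀ E)) p
  from : ∀ p → EdgeOf E p → Parts p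
  from (zero  , suc j) (_ , e)       = inj₁ (j , e , refl)
  from (suc i , suc j) (i<j , e)     = inj₂ ((i , j) , (s≤s⁻¹ i<j , e) , refl)
  classify : ∀ p → Parts p ⇔ EdgeOf E p
  classify p = mk⇔ (λ { (inj₁ (_ , e , refl)) → s≤s z≤n , e
                      ; (inj₂ ((_ , _) , (i<j , e) , refl)) → s≤s i<j , e })
                   (from p)

edgeCount-resp : E ≐ E′ → edgeCount E ≡ edgeCount E′
edgeCount-resp {E = E} {E′} E≐E′ =
  HasCount-unique (edgeCount-count E)
    (HasCount-⇔ (λ { (i , j) → mk⇔ (Product.map₂ (trans (E≐E′ i j)))
                                   (Product.map₂ (trans (sym (E≐E′ i j)))) })
                (edgeCount-count E′))

edgeCount-attach : HasCount (λ j → N j ≡ true) k → edgeCount (attach E N) ≡ k + edgeCount E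
edgeCount-attach {E = E} N-count = cong (_+ edgeCount E) (HasCount-unique (neighbours₀-count (attach E _)) N-count)

Rooted : Graph n → List (Fin n) → Set
Rooted E D = ∀ u → ∃[ d ] d ∈ D × E ∋ u ⇝ d

Rooted-reroot : {D : List (Fin n)} → Symmetric E → Rooted E D → (r : Fin n) →
                ∃[ D′ ] r ∈ D′ × length D′ ≡ length D × Rooted E D′
Rooted-reroot {E = E} E-sym rooted r with rooted r
... | d , d∈D , r⇝d with ∈-∃++ d∈D
... | D₁ , D₂ , refl = r ∷ D₁ ++ D₂ , here refl , sym (length-++-sucʳ D₁ d D₂) , rooted′
  where
  rooted′ : Rooted E (r ∷ D₁ ++ D₂)
  rooted′ u with rooted u
  ... | d′ , d′∈D , u⇝d′ with ∈-++⁻ D₁ d′∈D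
  ...   | inj₁ d′∈D₁         = d′ , there (∈-++⁺ˡ d′∈D₁) , u⇝d′
  ...   | inj₂ (here refl)   = r , here refl , u⇝d′ ◅◅ ⇝-reverse E-sym r⇝d
  ...   | inj₂ (there d′∈D₂) = d′ , there (∈-++⁺ʳ D₁ d′∈D₂) , u⇝d′

private
  dropZero : List (Fin (suc n)) → List (Fin n)
  dropZero []          = []
  dropZero (zero ∷ D)  = dropZero D
  dropZero (suc d ∷ D) = d ∷ dropZero D

  dropZero-∈ : (D : List (Fin (suc n))) → suc v ∈ D → v ∈ dropZero D
  dropZero-∈ (zero ∷ D)  (there v∈D)  = dropZero-∈ D v∈D
  dropZero-∈ (suc d ∷ D) (here refl)  = here refl
  dropZero-∈ (suc d ∷ D) (there v∈D)  = there (dropZero-∈ D v∈D)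

  length-dropZero-≤ : (D : List (Fin (suc n))) → length (dropZero D) ≤ length D
  length-dropZero-≤ []          = z≤n
  length-dropZero-≤ (zero ∷ D)  = m≤n⇒m≤1+n (length-dropZero-≤ D)
  length-dropZero-≤ (suc d ∷ D) = s≤s (length-dropZero-≤ D)

  length-dropZero-< : (D : List (Fin (suc n))) → zero ∈ D → suc (length (dropZero D)) ≤ length D
  length-dropZero-< (zero ∷ D)  _           = s≤s (length-dropZero-≤ D)
  length-dropZero-< (suc d ∷ D) (there 0∈D) = s≤s (length-dropZero-< D 0∈D)

Rooted-delete₀ : {D : List (Fin (suc n))} → Symmetric E → Rooted E D →
                 Rooted (delete₀ E) (dropZero D ++ neighbours₀ E)
Rooted-delete₀ {E = E} {D} E-sym rooted u with rooted (suc u)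
... | d , d∈D , p with ⇝-split₀ E-sym p
...   | inj₂ (c , c~0 , q) = c , ∈-++⁺ʳ (dropZero D) (∈-neighbours₀ {E = E} c~0) , q
...   | inj₁ q = toRoot d d∈D q
  where
  toRoot : ∀ d → d ∈ D → Avoids₀ E u d →
           ∃[ d′ ] d′ ∈ dropZero D ++ neighbours₀ E × delete₀ E ∋ u ⇝ d′
  toRoot (suc d) d∈D q = d , ∈-++⁺ˡ (dropZero-∈ D d∈D) , q

-- Make vertex 0 a root, then delete it and make its neighbours roots instead; each of them
-- accounts for one deleted edge.
edgeCount-lowerBound : {D : List (Fin n)} → Symmetric E → Rooted E D → n ≤ edgeCount E + length D
edgeCount-lowerBound {zero} _ _ = z≤n
edgeCount-lowerBound {suc n} {E} E-sym rooted with Rooted-reroot E-sym rooted zero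
... | D , 0∈D , |D|≡ , rootedD = subst (λ l → suc n ≤ edgeCount E + l) |D|≡ (begin
  suc n                                      ≤⟨ s≤s (edgeCount-lowerBound delete₀-sym rooted₀) ⟩
  suc (e₀ + length (dropZero D ++ N₀))       ≡⟨ cong (λ l → suc (e₀ + l)) (length-++ (dropZero D)) ⟩
  suc (e₀ + (length (dropZero D) + length N₀)) ≡⟨ shuffle e₀ (length (dropZero D)) (length N₀) ⟩
  length N₀ + e₀ + suc (length (dropZero D)) ≤⟨ +-monoʳ-≤ (edgeCount E) (length-dropZero-< D 0∈D) ⟩
  edgeCount E + length D                     ∎)
  where
  open ≤-Reasoning
  N₀ = neighbours₀ E
  e₀ = edgeCount (delete₀ E)
  rooted₀ = Rooted-delete₀ E-sym rootedD
  delete₀-sym : Symmetric (delete₀ E)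
  delete₀-sym i j = E-sym (suc i) (suc j)
  shuffle : ∀ x y z → suc (x + (y + z)) ≡ z + x + suc y
  shuffle = solve-∀

-- Spanning trees and spanning forests with two roots

record SimpleSubgraph (G E : Graph n) : Set where
  constructor simple
  field
    symmetric   : Symmetric E
    irreflexive : Irreflexive E
    ⊆G          : ∀ i j → E i j ≡ true → G i j ≡ true

open SimpleSubgraph using (symmetric)

record SpanningTree (G E : Graph n) : Set where
  constructor spanningTree
  field
    simpleSub : SimpleSubgraph G E
    connected : IsConnected E
    size      : edgeCount E ≡ n ∸ 1

-- Having n - 2 edges forces a and b into different components (SpanningForest-roots-apart),
-- so these are the spanning forests with two trees, one containing a and the other b.
record SpanningForest (G : Graph n) (a b : Fin n) (E : Graph n) : Set where
  constructor spanningForest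
  field
    simpleSub : SimpleSubgraph G E
    rooted    : ∀ u → E ∋ u ⇝ a ⊎ E ∋ u ⇝ b
    size      : edgeCount E ≡ n ∸ 2

SimpleSubgraph-resp : G ≐ G′ → E ≐ E′ → SimpleSubgraph G E → SimpleSubgraph G′ E′
SimpleSubgraph-resp G≐G′ E≐E′ (simple E-sym irr ⊆G) =
  simple (λ i j → trans (sym (E≐E′ i j)) (trans (E-sym i j) (E≐E′ j i)))
         (λ i → trans (sym (E≐E′ i i)) (irr i))
         (λ i j e → trans (sym (G≐G′ i j)) (⊆G i j (trans (E≐E′ i j) e)))

SpanningTree-resp : G ≐ G′ → E ≐ E′ → SpanningTree G E → SpanningTree G′ E′
SpanningTree-resp G≐G′ E≐E′ (spanningTree s conn size) =
  spanningTree (SimpleSubgraph-resp G≐G′ E≐E′ s) (λ u v → ⇝-resp E≐E′ (conn u v))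
               (trans (sym (edgeCount-resp E≐E′)) size)

SpanningForest-resp : G ≐ G′ → E ≐ E′ → SpanningForest G a b E → SpanningForest G′ a b E′
SpanningForest-resp G≐G′ E≐E′ (spanningForest s rooted size) =
  spanningForest (SimpleSubgraph-resp G≐G′ E≐E′ s) (Sum.map (⇝-resp E≐E′) (⇝-resp E≐E′) ∘ rooted)
                 (trans (sym (edgeCount-resp E≐E′)) size)

SpanningForest-roots-apart : ∀ {n} {G : Graph n} {a b E} → SpanningForest G a b E → ¬ Adj E a b
SpanningForest-roots-apart {n = suc zero} {a = zero} {b = zero} (spanningForest (simple _ irr _) _ _) a~b =
  contradiction (trans (sym a~b) (irr zero)) λ ()
SpanningForest-roots-apart {n = suc (suc m)} {a = a} {E = E} (spanningForest (simple E-sym _ _) rooted size) a~b =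
  <-irrefl refl (≤-trans (edgeCount-lowerBound E-sym to-a) (≤-reflexive (trans (cong (_+ 1) size) (+-comm m 1))))
  where
  to-a : Rooted E (a ∷ [])
  to-a u = a , here refl , [ (λ p → p) , (λ p → p ◅◅ (trans (E-sym _ _) a~b ◅ ε)) ] (rooted u)

toMatrix : Graph n → Matrix n
toMatrix E = tabulate λ i → tabulate (E i)

entry-toMatrix : (E : Graph n) → entry (toMatrix E) ≐ E
entry-toMatrix E i j = trans (cong (λ r → lookup r j) (lookup∘tabulate _ i)) (lookup∘tabulate (E i) j)

entry-injective : {M M′ : Matrix n} → entry M ≐ entry M′ → M ≡ M′
entry-injective {M = M} {M′} M≐M′ =
  trans (sym (toMatrix-entry M)) (trans (tabulate-cong λ i → tabulate-cong (M≐M′ i)) (toMatrix-entry M′))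
  where
  toMatrix-entry : ∀ M → toMatrix (entry M) ≡ M
  toMatrix-entry M = trans (tabulate-cong (λ i → tabulate∘lookup (lookup M i))) (tabulate∘lookup M)

Matrix-≟ : DecidableEquality (Matrix n)
Matrix-≟ = Vec.≡-dec (Vec.≡-dec Bool._≟_)

Trees : Graph n → Matrix n → Set
Trees G T = SpanningTree G (entry T)

Forests : Graph n → Fin n → Fin n → Matrix n → Set
Forests G a b T = SpanningForest G a b (entry T)

IsSpanningTree⇔Trees : IsSpanningTree G T ⇔ Trees G T
IsSpanningTree⇔Trees {T = T} = mk⇔
  (λ (E-sym , irr , ⊆G , conn , edges) →
     spanningTree (simple E-sym irr ⊆G) (λ u v → Walk⇒⇝ (conn u v))
                  (HasCount-unique (edgeCount-count (entry T)) edges))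
  (λ (spanningTree (simple E-sym irr ⊆G) conn size) →
     E-sym , irr , ⊆G , (λ u v → ⇝⇒Walk (conn u v)) , subst (HasCount (IsEdge T)) size (edgeCount-count (entry T)))
  where
  Walk⇒⇝ : Walk T u v → entry T ∋ u ⇝ v
  Walk⇒⇝ here       = ε
  Walk⇒⇝ (step e p) = e ◅ Walk⇒⇝ p
  ⇝⇒Walk : entry T ∋ u ⇝ v → Walk T u v
  ⇝⇒Walk ε       = here
  ⇝⇒Walk (e ◅ p) = step e (⇝⇒Walk p)

-- Relabelling vertices

infix 4 _≅_
record _≅_ (G H : Graph n) : Set where
  constructor mk≅
  field
    perm     : Permutation′ n
    ≐relabel : G ≐ relabel perm H

module ≅ = _≅_

≐⇒≅ : G ≐ H → G ≅ H
≐⇒≅ G≐H = mk≅ id G≐H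

≅-trans : G ≅ H → H ≅ K → G ≅ K
≅-trans (mk≅ π G≐πH) (mk≅ ρ H≐ρK) = mk≅ (π ∘ₚ ρ) λ i j → trans (G≐πH i j) (H≐ρK _ _)

≅-sym : G ≅ H → H ≅ G
≅-sym {G = G} {H = H} (mk≅ π G≐πH) =
  mk≅ (flip π) λ i j → trans (sym (cong₂ H (inverseʳ π) (inverseʳ π))) (sym (G≐πH _ _))

⟨$⟩ʳ-injective : (π : Permutation′ n) → π ⟨$⟩ʳ u ≡ π ⟨$⟩ʳ v → u ≡ v
⟨$⟩ʳ-injective π e = trans (sym (inverseˡ π)) (trans (cong (π ⟨$⟩ˡ_) e) (inverseˡ π))

⟨$⟩ˡ-injective : (π : Permutation′ n) → π ⟨$⟩ˡ u ≡ π ⟨$⟩ˡ v → u ≡ v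
⟨$⟩ˡ-injective π e = trans (sym (inverseʳ π)) (trans (cong (π ⟨$⟩ʳ_) e) (inverseʳ π))

relabel-inverse : (E : Graph n) (π ρ : Permutation′ n) → (∀ i → π ⟨$⟩ʳ (ρ ⟨$⟩ʳ i) ≡ i) →
                  relabel ρ (relabel π E) ≐ E
relabel-inverse E π ρ πρ≗id i j = cong₂ E (πρ≗id i) (πρ≗id j)

⌊≟⌋-relabel : (π : Permutation′ n) (i j : Fin n) → ⌊ π ⟨$⟩ʳ i ≟ π ⟨$⟩ʳ j ⌋ ≡ ⌊ i ≟ j ⌋
⌊≟⌋-relabel π i j with i ≟ j
... | yes refl = ⌊≟⌋-refl _
... | no i≢j   = ⌊≟⌋-≢ (i≢j ∘ ⟨$⟩ʳ-injective π)

SimpleSubgraph-relabel : (π : Permutation′ n) → SimpleSubgraph H E → SimpleSubgraph (relabel π H) (relabel π E)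
SimpleSubgraph-relabel π (simple E-sym irr ⊆H) = simple (λ i j → E-sym _ _) (λ i → irr _) (λ i j → ⊆H _ _)

⇝-relabel : (π : Permutation′ n) → E ∋ u ⇝ v → relabel π E ∋ π ⟨$⟩ˡ u ⇝ π ⟨$⟩ˡ v
⇝-relabel {E = E} π = gmap (π ⟨$⟩ˡ_) (λ e → subst₂ (Adj E) (sym (inverseʳ π)) (sym (inverseʳ π)) e)

IsConnected-relabel : (π : Permutation′ n) → IsConnected E → IsConnected (relabel π E)
IsConnected-relabel {E = E} π conn u v =
  subst₂ (relabel π E ∋_⇝_) (inverseˡ π) (inverseˡ π) (⇝-relabel π (conn _ _))

private
  double-injective : ∀ {x y} → x + x ≡ y + y → x ≡ y
  double-injective {zero}  {zero}  _ = refl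
  double-injective {suc x} {suc y} e =
    cong suc (double-injective (suc-injective (trans (sym (+-suc x x)) (trans (suc-injective e) (+-suc y y)))))

Arc : Graph n → Fin n × Fin n → Set
Arc E (i , j) = E i j ≡ true

arcs-count : Symmetric E → Irreflexive E → HasCount (Arc E) (edgeCount E + edgeCount E)
arcs-count {E = E} E-sym irr =
  HasCount-⇔ (λ p → mk⇔ [ proj₂ , (λ { (_ , (_ , e) , refl) → trans (E-sym _ _) e }) ] (split p))
    (HasCount-⊎ (edgeCount-count E) (HasCount-image Product.swap (λ { {_ , _} {_ , _} refl → refl }) (edgeCount-count E))
                (λ { _ (i<j , _) (_ , (j<i , _) , refl) → <-asym i<j j<i }))
  where
  split : ∀ p → Arc E p → EdgeOf E p ⊎ Image Product.swap (EdgeOf E) p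
  split (i , j) e with <-cmp i j
  ... | tri< i<j _ _ = inj₁ (i<j , e)
  ... | tri≈ _ refl _ = contradiction (trans (sym e) (irr i)) λ ()
  ... | tri> _ _ j<i = inj₂ ((j , i) , (j<i , trans (E-sym j i) e) , refl)

edgeCount-relabel : (π : Permutation′ n) → Symmetric E → Irreflexive E → edgeCount (relabel π E) ≡ edgeCount E
edgeCount-relabel {E = E} π E-sym irr =
  double-injective (HasCount-unique (arcs-count (λ i j → E-sym _ _) (λ i → irr _))
    (HasCount-↔ (mk↔ₛ′ (Product.map (π ⟨$⟩ˡ_) (π ⟨$⟩ˡ_)) (Product.map (π ⟨$⟩ʳ_) (π ⟨$⟩ʳ_))
                       (λ _ → cong₂ _,_ (inverseˡ π) (inverseˡ π))
                       (λ _ → cong₂ _,_ (inverseʳ π) (inverseʳ π)))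
                (λ { (i , j) → mk⇔ (subst₂ (Adj E) (sym (inverseʳ π)) (sym (inverseʳ π)))
                                   (subst₂ (Adj E) (inverseʳ π) (inverseʳ π)) })
                (arcs-count E-sym irr)))

SpanningTree-relabel : (π : Permutation′ n) → SpanningTree H E → SpanningTree (relabel π H) (relabel π E)
SpanningTree-relabel π (spanningTree s@(simple E-sym irr _) conn size) =
  spanningTree (SimpleSubgraph-relabel π s) (IsConnected-relabel π conn) (trans (edgeCount-relabel π E-sym irr) size)

relabelᴹ : Permutation′ n → Matrix n → Matrix n
relabelᴹ π T = toMatrix (relabel π (entry T))

relabelᴹ-inverse : (π ρ : Permutation′ n) → (∀ i → π ⟨$⟩ʳ (ρ ⟨$⟩ʳ i) ≡ i) →
                   relabelᴹ ρ (relabelᴹ π T) ≡ T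
relabelᴹ-inverse {T = T} π ρ πρ≗id =
  entry-injective λ i j → trans (entry-toMatrix _ i j)
    (trans (entry-toMatrix (relabel π (entry T)) _ _) (relabel-inverse (entry T) π ρ πρ≗id i j))

trees-≅ : G ≅ H → HasCount (Trees H) k → HasCount (Trees G) k
trees-≅ {G = G} {H} (mk≅ π G≐πH) =
  HasCount-↔ (mk↔ₛ′ (relabelᴹ π) (relabelᴹ (flip π))
                     (λ _ → relabelᴹ-inverse (flip π) π (λ _ → inverseˡ π))
                     (λ _ → relabelᴹ-inverse π (flip π) (λ _ → inverseʳ π)))
             (λ T → mk⇔ (SpanningTree-resp (λ i j → sym (G≐πH i j)) (λ i j → sym (entry-toMatrix _ i j))
                         ∘ SpanningTree-relabel π)
                        (SpanningTree-resp (relabel-inverse H π (flip π) (λ _ → inverseʳ π))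
                                           (relabel-inverse (entry T) π (flip π) (λ _ → inverseʳ π))
                         ∘ SpanningTree-relabel (flip π)
                         ∘ SpanningTree-resp G≐πH (entry-toMatrix _)))

extend-symmetric : Symmetric G → Symmetric (extend G a b)
extend-symmetric G-sym zero    zero    = refl
extend-symmetric G-sym zero    (suc j) = refl
extend-symmetric G-sym (suc i) zero    = refl
extend-symmetric G-sym (suc i) (suc j) = G-sym i j

extend-resp : G ≐ H → extend G a b ≐ extend H a b
extend-resp G≐H zero    zero    = refl
extend-resp G≐H zero    (suc j) = refl
extend-resp G≐H (suc i) zero    = refl
extend-resp G≐H (suc i) (suc j) = G≐H i j

extend-comm : (G : Graph n) (a b : Fin n) → extend G a b ≐ extend G b a
extend-comm G a b zero    zero    = refl
extend-comm G a b zero    (suc j) = Bool.∨-comm ⌊ j ≟ a ⌋ _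
extend-comm G a b (suc i) zero    = Bool.∨-comm ⌊ i ≟ a ⌋ _
extend-comm G a b (suc i) (suc j) = refl

extend-≅ : (σ : G ≅ H) → extend G a b ≅ extend H (≅.perm σ ⟨$⟩ʳ a) (≅.perm σ ⟨$⟩ʳ b)
extend-≅ {a = a} {b = b} (mk≅ π G≐πH) = mk≅ (lift₀ π) λ where
  zero    zero    → refl
  zero    (suc j) → sym (cong₂ _∨_ (⌊≟⌋-relabel π j a) (⌊≟⌋-relabel π j b))
  (suc i) zero    → sym (cong₂ _∨_ (⌊≟⌋-relabel π i a) (⌊≟⌋-relabel π i b))
  (suc i) (suc j) → G≐πH i j

extend₂ : Graph n → (a b c d : Fin n) → Graph (2 + n)
extend₂ G a b c d = extend (extend G c d) (suc a) (suc b)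

extend₂-swap : (G : Graph n) (a b c d : Fin n) → extend₂ G a b c d ≅ extend₂ G c d a b
extend₂-swap G a b c d = mk≅ (transpose 0F 1F) λ where
  zero                zero                → refl
  zero                (suc zero)          → refl
  zero                (suc (suc j))       → cong₂ _∨_ (⌊suc≟suc⌋ j a) (⌊suc≟suc⌋ j b)
  (suc zero)          zero                → refl
  (suc zero)          (suc zero)          → refl
  (suc zero)          (suc (suc j))       → sym (cong₂ _∨_ (⌊suc≟suc⌋ j c) (⌊suc≟suc⌋ j d))
  (suc (suc i))       zero                → cong₂ _∨_ (⌊suc≟suc⌋ i a) (⌊suc≟suc⌋ i b)
  (suc (suc i))       (suc zero)          → sym (cong₂ _∨_ (⌊suc≟suc⌋ i c) (⌊suc≟suc⌋ i d))
  (suc (suc i))       (suc (suc j))       → refl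

complete : (n : ℕ) → Graph n
complete n i j = not ⌊ i ≟ j ⌋

K₃ : Graph 3
K₃ = complete 3

complete-symmetric : Symmetric (complete n)
complete-symmetric i j with i ≟ j
... | yes refl = cong not (sym (⌊≟⌋-refl i))
... | no i≢j   = cong not (sym (⌊≟⌋-≢ (i≢j ∘ sym)))

complete-≅ : (π : Permutation′ n) → complete n ≅ complete n
complete-≅ π = mk≅ π λ i j → cong not (sym (⌊≟⌋-relabel π i j))

-- Attaching a vertex

attach-resp : E ≐ E′ → (∀ j → N j ≡ N′ j) → attach E N ≐ attach E′ N′
attach-resp E≐E′ N≗N′ zero    zero    = refl
attach-resp E≐E′ N≗N′ zero    (suc j) = N≗N′ j
attach-resp E≐E′ N≗N′ (suc i) zero    = N≗N′ i
attach-resp E≐E′ N≗N′ (suc i) (suc j) = E≐E′ i j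

attach-connected⇔ : Symmetric E → IsConnected (attach E N) ⇔ (∀ u → ∃[ c ] N c ≡ true × E ∋ u ⇝ c)
attach-connected⇔ {E = E} {N = N} E-sym = mk⇔
  (λ conn u → ⇝zero⇒Reaches₀ (attach-symmetric E-sym) (conn (suc u) zero))
  (λ reach → IsConnected-via (attach-symmetric E-sym) (to-zero reach))
  where
  to-zero : (∀ u → ∃[ c ] N c ≡ true × E ∋ u ⇝ c) → ∀ u → attach E N ∋ u ⇝ zero
  to-zero reach zero    = ε
  to-zero reach (suc u) = let (c , Nc , u⇝c) = reach u in ⇝-suc {E = attach E N} u⇝c ◅◅ (Nc ◅ ε)

attach-rooted⇔ : Symmetric E →
                 (∀ u → attach E N ∋ u ⇝ zero ⊎ attach E N ∋ u ⇝ suc a) ⇔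
                 (∀ u → E ∋ u ⇝ a ⊎ ∃[ c ] N c ≡ true × E ∋ u ⇝ c)
attach-rooted⇔ {E = E} {N = N} {a = a} E-sym = mk⇔
  (λ rooted u → [ inj₂ ∘ ⇝zero⇒Reaches₀ (attach-symmetric E-sym) , ⇝-split₀ (attach-symmetric E-sym) ]
                   (rooted (suc u)))
  from
  where
  from : (∀ u → E ∋ u ⇝ a ⊎ ∃[ c ] N c ≡ true × E ∋ u ⇝ c) →
         ∀ u → attach E N ∋ u ⇝ zero ⊎ attach E N ∋ u ⇝ suc a
  from rooted zero    = inj₁ ε
  from rooted (suc u) = [ inj₂ ∘ ⇝-suc {E = attach E N}
                        , (λ (c , Nc , u⇝c) → inj₁ (⇝-suc {E = attach E N} u⇝c ◅◅ (Nc ◅ ε))) ] (rooted u)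

module Extension {m} (G : Graph (2 + m)) {a b : Fin (2 + m)} (a≢b : a ≢ b) where

  G⁺ : Graph (3 + m)
  G⁺ = extend G a b

  links : Bool → Bool → Fin (2 + m) → Bool
  links p q j = (p ∧ ⌊ j ≟ a ⌋) ∨ (q ∧ ⌊ j ≟ b ⌋)

  links-true : ∀ p q j → links p q j ≡ true → (p ≡ true × j ≡ a) ⊎ (q ≡ true × j ≡ b)
  links-true true  q     j e with ∨-true {⌊ j ≟ a ⌋} e
  ... | inj₁ j≟a = inj₁ (refl , ⌊≟⌋-true j≟a)
  links-true true  true  j e | inj₂ j≟b = inj₂ (refl , ⌊≟⌋-true j≟b)
  links-true false true  j e = inj₂ (refl , ⌊≟⌋-true e)

  links-a : ∀ p q → links p q a ≡ p
  links-a p q rewrite ⌊≟⌋-refl a | ⌊≟⌋-≢ a≢b =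
    trans (cong₂ _∨_ (Bool.∧-identityʳ p) (Bool.∧-zeroʳ q)) (Bool.∨-identityʳ p)

  links-b : ∀ p q → links p q b ≡ q
  links-b p q rewrite ⌊≟⌋-refl b | ⌊≟⌋-≢ (a≢b ∘ sym) =
    trans (cong₂ _∨_ (Bool.∧-zeroʳ p) (Bool.∧-identityʳ q)) (Bool.∨-identityˡ q)

  links-count : ∀ p q → HasCount (λ j → links p q j ≡ true) ((if p then 1 else 0) + (if q then 1 else 0))
  links-count p q =
    HasCount-⇔ (λ j → mk⇔ [ (λ { (refl , refl) → links-a true q }) , (λ { (refl , refl) → links-b p true }) ]
                          (links-true p q j))
      (HasCount-⊎ (when p a) (when q b) (λ { _ (_ , refl) (_ , j≡b) → a≢b j≡b }))
    where
    when : ∀ p c → HasCount (λ j → p ≡ true × j ≡ c) (if p then 1 else 0)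
    when true  c = HasCount-⇔ (λ j → mk⇔ (refl ,_) proj₂) (HasCount-≡ c)
    when false c = HasCount-∅ λ { _ (() , _) }

  reach-links⇔ : ∀ p q {E : Graph (2 + m)} {u} →
                 (∃[ c ] links p q c ≡ true × E ∋ u ⇝ c) ⇔
                 ((p ≡ true × E ∋ u ⇝ a) ⊎ (q ≡ true × E ∋ u ⇝ b))
  reach-links⇔ p q {E} {u} = mk⇔
    (λ (c , link , u⇝c) → Sum.map (λ (p≡true , c≡a) → p≡true , subst (E ∋ u ⇝_) c≡a u⇝c)
                                  (λ (q≡true , c≡b) → q≡true , subst (E ∋ u ⇝_) c≡b u⇝c)
                                  (links-true p q c link))
    [ (λ { (refl , u⇝a) → a , links-a true q , u⇝a }) , (λ { (refl , u⇝b) → b , links-b p true , u⇝b }) ]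

  attach-simple⇔ : ∀ p q {E} → SimpleSubgraph G E ⇔ SimpleSubgraph G⁺ (attach E (links p q))
  attach-simple⇔ p q {E} = mk⇔
    (λ (simple E-sym irr ⊆G) → simple (attach-symmetric E-sym) (attach-irreflexive irr) (⊆G⁺ ⊆G))
    (λ (simple E-sym irr ⊆G⁺) →
       simple (λ i j → E-sym (suc i) (suc j)) (λ i → irr (suc i)) (λ i j → ⊆G⁺ (suc i) (suc j)))
    where
    links⊆ : ∀ j → links p q j ≡ true → ⌊ j ≟ a ⌋ ∨ ⌊ j ≟ b ⌋ ≡ true
    links⊆ j e with links-true p q j e
    ... | inj₁ (_ , refl) = cong (_∨ ⌊ a ≟ b ⌋) (⌊≟⌋-refl a)
    ... | inj₂ (_ , refl) = trans (cong (⌊ b ≟ a ⌋ ∨_) (⌊≟⌋-refl b)) (Bool.∨-zeroʳ _)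
    ⊆G⁺ : (∀ i j → E i j ≡ true → G i j ≡ true) →
          ∀ i j → attach E (links p q) i j ≡ true → G⁺ i j ≡ true
    ⊆G⁺ ⊆G zero    (suc j) = links⊆ j
    ⊆G⁺ ⊆G (suc i) zero    = links⊆ i
    ⊆G⁺ ⊆G (suc i) (suc j) = ⊆G i j

  row₀≗links : {E′ : Graph (3 + m)} → SimpleSubgraph G⁺ E′ →
               ∀ j → row₀ E′ j ≡ links (row₀ E′ a) (row₀ E′ b) j
  row₀≗links {E′} (simple _ _ ⊆G⁺) j = by-cases (j ≟ a) (j ≟ b)
    where
    Goal : Fin (2 + m) → Set
    Goal k = row₀ E′ k ≡ links (row₀ E′ a) (row₀ E′ b) k
    by-cases : Dec (j ≡ a) → Dec (j ≡ b) → Goal j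
    by-cases (yes j≡a) _         = subst Goal (sym j≡a) (sym (links-a _ _))
    by-cases (no _)    (yes j≡b) = subst Goal (sym j≡b) (sym (links-b _ _))
    by-cases (no j≢a)  (no j≢b)  =
      trans (Bool.¬-not (Bool.not-¬ (⌊≟⌋-∨-≢ j≢a j≢b) ∘ ⊆G⁺ zero (suc j)))
            (sym (Bool.¬-not ([ j≢a ∘ proj₂ , j≢b ∘ proj₂ ] ∘ links-true (row₀ E′ a) (row₀ E′ b) j)))

  glue : Bool → Bool → Matrix (2 + m) → Matrix (3 + m)
  glue p q T = toMatrix (attach (entry T) (links p q))

  restrict : Matrix (3 + m) → Matrix (2 + m)
  restrict T′ = toMatrix (delete₀ (entry T′))

  entry-glue : ∀ p q T → entry (glue p q T) ≐ attach (entry T) (links p q)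
  entry-glue p q T = entry-toMatrix (attach (entry T) (links p q))

  restrict-glue : ∀ p q T → restrict (glue p q T) ≡ T
  restrict-glue p q T = entry-injective λ i j →
    trans (entry-toMatrix (delete₀ (entry (glue p q T))) i j) (entry-glue p q T (suc i) (suc j))

  glue-links-a : ∀ p q T → entry (glue p q T) zero (suc a) ≡ p
  glue-links-a p q T = trans (entry-glue p q T zero (suc a)) (links-a p q)

  glue-links-b : ∀ p q T → entry (glue p q T) zero (suc b) ≡ q
  glue-links-b p q T = trans (entry-glue p q T zero (suc b)) (links-b p q)

  glue-η : {T′ : Matrix (3 + m)} → SimpleSubgraph G⁺ (entry T′) →
           glue (row₀ (entry T′) a) (row₀ (entry T′) b) (restrict T′) ≡ T′
  glue-η {T′} s@(simple E-sym irr _) = entry-injective λ i j →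
    trans (entry-toMatrix (attach (entry (restrict T′)) (links (row₀ (entry T′) a) (row₀ (entry T′) b))) i j)
      (trans (attach-resp (entry-toMatrix (delete₀ (entry T′))) (λ j → sym (row₀≗links s j)) i j)
             (sym (attach-η E-sym irr i j)))

  attach-tree-pendant⇔ : ∀ p q {E} (c : Fin (2 + m)) →
                         (∀ {u} → (∃[ c′ ] links p q c′ ≡ true × E ∋ u ⇝ c′) ⇔ E ∋ u ⇝ c) →
                         (if p then 1 else 0) + (if q then 1 else 0) ≡ 1 →
                         SpanningTree G E ⇔ SpanningTree G⁺ (attach E (links p q))
  attach-tree-pendant⇔ p q {E} c via-c one = mk⇔
    (λ (spanningTree s conn size) →
       spanningTree (⇔.to (attach-simple⇔ p q) s)
                    (⇔.from (attach-connected⇔ (symmetric s)) λ u → ⇔.from via-c (conn u c))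
                    (trans edgeCount-attach₁ (cong suc size)))
    (λ (spanningTree s⁺ conn size) → let s = ⇔.from (attach-simple⇔ p q) s⁺ in
       spanningTree s
                    (IsConnected-via (symmetric s)
                                     (λ u → ⇔.to via-c (⇔.to (attach-connected⇔ (symmetric s)) conn u)))
                    (suc-injective (trans (sym edgeCount-attach₁) size)))
    where
    edgeCount-attach₁ : edgeCount (attach E (links p q)) ≡ suc (edgeCount E)
    edgeCount-attach₁ = trans (edgeCount-attach {E = E} (links-count p q)) (cong (_+ edgeCount E) one)

  attach-tree-forest⇔ : ∀ {E} → SpanningForest G a b E ⇔ SpanningTree G⁺ (attach E (links true true))
  attach-tree-forest⇔ {E} = mk⇔
    (λ (spanningForest s rooted size) →
       spanningTree (⇔.to (attach-simple⇔ true true) s)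
                    (⇔.from (attach-connected⇔ (symmetric s))
                            λ u → ⇔.from (reach-links⇔ true true) (Sum.map (refl ,_) (refl ,_) (rooted u)))
                    (trans (edgeCount-attach {E = E} (links-count true true)) (cong (2 +_) size)))
    (λ (spanningTree s⁺ conn size) → let s = ⇔.from (attach-simple⇔ true true) s⁺ in
       spanningForest s
                      (λ u → Sum.map proj₂ proj₂
                               (⇔.to (reach-links⇔ true true) (⇔.to (attach-connected⇔ (symmetric s)) conn u)))
                      (suc-injective (suc-injective (trans (sym (edgeCount-attach {E = E} (links-count true true))) size))))

  attach-no-tree : ∀ {E} → ¬ SpanningTree G⁺ (attach E (links false false))
  attach-no-tree (spanningTree _ conn _) with conn zero (suc a)
  ... | _◅_ {j = zero}  () _
  ... | _◅_ {j = suc _} () _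

  attach-forest-tree⇔ : ∀ {E} → SpanningTree G E ⇔ SpanningForest G⁺ zero (suc a) (attach E (links false false))
  attach-forest-tree⇔ {E} = mk⇔
    (λ (spanningTree s conn size) →
       spanningForest (⇔.to (attach-simple⇔ false false) s)
                      (⇔.from (attach-rooted⇔ (symmetric s)) λ u → inj₁ (conn u a))
                      (trans (edgeCount-attach {E = E} (links-count false false)) size))
    (λ (spanningForest s⁺ rooted size) → let s = ⇔.from (attach-simple⇔ false false) s⁺ in
       spanningTree s
                    (IsConnected-via (symmetric s)
                                     (λ u → Sum.[ (λ u⇝a → u⇝a) , (λ { (_ , () , _) }) ]′
                                              (⇔.to (attach-rooted⇔ (symmetric s)) rooted u)))
                    (trans (sym (edgeCount-attach {E = E} (links-count false false))) size))

  attach-forest-forest⇔ : ∀ {E} →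
                          SpanningForest G a b E ⇔ SpanningForest G⁺ zero (suc a) (attach E (links false true))
  attach-forest-forest⇔ {E} = mk⇔
    (λ (spanningForest s rooted size) →
       spanningForest (⇔.to (attach-simple⇔ false true) s)
                      (⇔.from (attach-rooted⇔ (symmetric s))
                              λ u → Sum.map₂ (λ u⇝b → ⇔.from (reach-links⇔ false true) (inj₂ (refl , u⇝b)))
                                             (rooted u))
                      (trans (edgeCount-attach {E = E} (links-count false true)) (cong suc size)))
    (λ (spanningForest s⁺ rooted size) → let s = ⇔.from (attach-simple⇔ false true) s⁺ in
       spanningForest s
                      (λ u → Sum.map₂ (Sum.[ (λ { (() , _) }) , proj₂ ]′ ∘ ⇔.to (reach-links⇔ false true))
                                      (⇔.to (attach-rooted⇔ (symmetric s)) rooted u))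
                      (suc-injective (trans (sym (edgeCount-attach {E = E} (links-count false true))) size)))

  attach-no-forest : ∀ q {E} → ¬ SpanningForest G⁺ zero (suc a) (attach E (links true q))
  attach-no-forest q forest = SpanningForest-roots-apart forest (links-a true q)

  -- A simple subgraph of G⁺ is determined by whether the new vertex is linked to a and to b
  -- and by its restriction to G (glue-η).
  count-by-links : (P : Matrix (3 + m) → Set) → (∀ {T′} → P T′ → SimpleSubgraph G⁺ (entry T′)) →
                   (Q : Bool → Bool → Matrix (2 + m) → Set) → (∀ p q T → P (glue p q T) ⇔ Q p q T) →
                   ∀ {k₁ k₂ k₃ k₄} → HasCount (Q true true) k₁ → HasCount (Q true false) k₂ →
                   HasCount (Q false true) k₃ → HasCount (Q false false) k₄ →
                   HasCount P ((k₁ + k₂) + (k₃ + k₄))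
  count-by-links P simple-P Q P⇔Q c₁₁ c₁₀ c₀₁ c₀₀ =
    HasCount-⇔ (λ T′ → mk⇔ (λ { ((p , q , T) , Qpq , refl) → ⇔.from (P⇔Q p q T) Qpq }) (decompose T′))
      (HasCount-image glue⁺ glue⁺-injective
        (HasCount-Bool {P = λ p → uncurry (Q p)} (HasCount-Bool {P = Q true} c₁₁ c₁₀)
                                                 (HasCount-Bool {P = Q false} c₀₁ c₀₀)))
    where
    glue⁺ : Bool × Bool × Matrix (2 + m) → Matrix (3 + m)
    glue⁺ (p , q , T) = glue p q T
    glue⁺-injective : ∀ {x y} → glue⁺ x ≡ glue⁺ y → x ≡ y
    glue⁺-injective {p , q , T} {p′ , q′ , T′} eq
      with trans (sym (glue-links-a p q T)) (trans (cong (λ M → entry M zero (suc a)) eq) (glue-links-a p′ q′ T′))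
         | trans (sym (glue-links-b p q T)) (trans (cong (λ M → entry M zero (suc b)) eq) (glue-links-b p′ q′ T′))
    ... | refl | refl =
      cong (λ T → p , q , T) (trans (sym (restrict-glue p q T)) (trans (cong restrict eq) (restrict-glue p q T′)))
    decompose : ∀ T′ → P T′ → Image glue⁺ (uncurry (λ p → uncurry (Q p))) T′
    decompose T′ PT′ = (row₀ (entry T′) a , row₀ (entry T′) b , restrict T′) ,
                       ⇔.to (P⇔Q _ _ _) (subst P (sym (glue-η (simple-P PT′))) PT′) , glue-η (simple-P PT′)

  TreeParts : Bool → Bool → Matrix (2 + m) → Set
  TreeParts true  true  = Forests G a b
  TreeParts true  false = Trees G
  TreeParts false true  = Trees G
  TreeParts false false = λ _ → ⊥

  ForestParts : Bool → Bool → Matrix (2 + m) → Set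
  ForestParts true  _     = λ _ → ⊥
  ForestParts false true  = Forests G a b
  ForestParts false false = Trees G

  trees-glue⇔ : ∀ p q T → Trees G⁺ (glue p q T) ⇔ TreeParts p q T
  trees-glue⇔ p q T = parts p q ⇔-∘ mk⇔ (SpanningTree-resp (λ _ _ → refl) (entry-glue p q T))
                                        (SpanningTree-resp (λ _ _ → refl) (λ i j → sym (entry-glue p q T i j)))
    where
    parts : ∀ p q → SpanningTree G⁺ (attach (entry T) (links p q)) ⇔ TreeParts p q T
    parts true  true  = ⇔-sym attach-tree-forest⇔
    parts true  false = ⇔-sym (attach-tree-pendant⇔ true false a
                                 (mk⇔ (Sum.[ proj₂ , (λ { (() , _) }) ]′ ∘ ⇔.to (reach-links⇔ true false))
                                      (⇔.from (reach-links⇔ true false) ∘ inj₁ ∘ (refl ,_))) refl)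
    parts false true  = ⇔-sym (attach-tree-pendant⇔ false true b
                                 (mk⇔ (Sum.[ (λ { (() , _) }) , proj₂ ]′ ∘ ⇔.to (reach-links⇔ false true))
                                      (⇔.from (reach-links⇔ false true) ∘ inj₂ ∘ (refl ,_))) refl)
    parts false false = mk⇔ attach-no-tree λ ()

  forests-glue⇔ : ∀ p q T → Forests G⁺ zero (suc a) (glue p q T) ⇔ ForestParts p q T
  forests-glue⇔ p q T = parts p q ⇔-∘ mk⇔ (SpanningForest-resp (λ _ _ → refl) (entry-glue p q T))
                                          (SpanningForest-resp (λ _ _ → refl) (λ i j → sym (entry-glue p q T i j)))
    where
    parts : ∀ p q → SpanningForest G⁺ zero (suc a) (attach (entry T) (links p q)) ⇔ ForestParts p q T
    parts true  q     = mk⇔ (attach-no-forest q) λ ()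
    parts false true  = ⇔-sym attach-forest-forest⇔
    parts false false = ⇔-sym attach-forest-tree⇔

  trees-extend : HasCount (Trees G) k → HasCount (Forests G a b) l → HasCount (Trees G⁺) (k + k + l)
  trees-extend {k} {l} trees forests =
    subst (HasCount (Trees G⁺)) (rearrange k l)
      (count-by-links (Trees G⁺) SpanningTree.simpleSub TreeParts trees-glue⇔ forests trees trees (HasCount-∅ λ _ ()))
    where
    rearrange : ∀ k l → (l + k) + (k + 0) ≡ k + k + l
    rearrange = solve-∀

  forests-extend : HasCount (Trees G) k → HasCount (Forests G a b) l → HasCount (Forests G⁺ zero (suc a)) (k + l)
  forests-extend {k} {l} trees forests =
    subst (HasCount (Forests G⁺ zero (suc a))) (+-comm l k)
      (count-by-links (Forests G⁺ zero (suc a)) SpanningForest.simpleSub ForestParts forests-glue⇔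
                      (HasCount-∅ λ _ ()) (HasCount-∅ λ _ ()) forests trees)

  forests-exist : HasCount (Trees G⁺) k → ∃[ l ] HasCount (Forests G a b) l
  forests-exist trees⁺ =
    Product.map₂ (HasCount-⇔ (trees-glue⇔ true true))
      (HasCount-preimage trees⁺ (glue true true) restrict (restrict-glue true true) Matrix-≟)

fib-step : ∀ i x → fib (2 + i) ≡ fib i + fib i + x → fib (2 + i) + fib (2 + i) + (fib i + x) ≡ fib (4 + i)
fib-step i x h = begin
  fib (2 + i) + fib (2 + i) + (fib i + x) ≡⟨ cong (fib (2 + i) + fib (2 + i) +_) (sym fib[1+i]≡fib[i]+x) ⟩
  fib (2 + i) + fib (2 + i) + fib (1 + i) ≡⟨ rearrange (fib (1 + i)) (fib i) ⟩
  fib (4 + i)                             ∎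
  where
  open ≡-Reasoning
  fib[1+i]≡fib[i]+x : fib (1 + i) ≡ fib i + x
  fib[1+i]≡fib[i]+x = +-cancelˡ-≡ (fib i) _ _ (trans (+-comm (fib i) _) (trans h (+-assoc (fib i) (fib i) x)))
  rearrange : ∀ a b → (a + b) + (a + b) + a ≡ ((a + b) + a) + (a + b)
  rearrange = solve-∀

fib-even-step : ∀ j x → fib (2 * suc j) ≡ fib (2 * j) + fib (2 * j) + x →
                fib (2 * suc j) + fib (2 * suc j) + (fib (2 * j) + x) ≡ fib (2 * suc (suc j))
fib-even-step j x h = begin
  fib (2 * suc j) + fib (2 * suc j) + (fib (2 * j) + x) ≡⟨ cong (λ t → t + t + (fib (2 * j) + x)) fib-2[1+j] ⟩
  fib (2 + 2 * j) + fib (2 + 2 * j) + (fib (2 * j) + x) ≡⟨ fib-step (2 * j) x (trans (sym fib-2[1+j]) h) ⟩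
  fib (4 + 2 * j)                                       ≡⟨ cong fib (cong (2 +_) (*-suc 2 j)) ⟨
  fib (2 + 2 * suc j)                                   ≡⟨ cong fib (*-suc 2 (suc j)) ⟨
  fib (2 * suc (suc j))                                 ∎
  where
  open ≡-Reasoning
  fib-2[1+j] : fib (2 * suc j) ≡ fib (2 + 2 * j)
  fib-2[1+j] = cong fib (*-suc 2 j)

trees-extend-extend : ∀ {m j} {C : Graph (2 + m)} {x y} → x ≢ y →
                      HasCount (Trees C) (fib (2 * j)) → HasCount (Trees (extend C x y)) (fib (2 * suc j)) →
                      HasCount (Trees (extend (extend C x y) zero (suc x))) (fib (2 * suc (suc j)))
trees-extend-extend {j = j} {C} {x} {y} x≢y trees-C trees-H =
  subst (HasCount (Trees (extend (extend C x y) zero (suc x)))) (fib-even-step j f trees-H≡) trees-H⁺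
  where
  module E = Extension C x≢y
  module E⁺ = Extension (extend C x y) {zero} {suc x} (λ ())
  forests-C : HasCount (Forests C x y) (proj₁ (E.forests-exist trees-H))
  forests-C = proj₂ (E.forests-exist trees-H)
  f : ℕ
  f = proj₁ (E.forests-exist trees-H)
  trees-H≡ : fib (2 * suc j) ≡ fib (2 * j) + fib (2 * j) + f
  trees-H≡ = HasCount-unique trees-H (E.trees-extend trees-C forests-C)
  trees-H⁺ : HasCount (Trees (extend (extend C x y) zero (suc x))) (fib (2 * suc j) + fib (2 * suc j) + (fib (2 * j) + f))
  trees-H⁺ = E⁺.trees-extend trees-H (E.forests-extend trees-C forests-C)

-- Simplicial vertices

complete-simplicial : (s : Fin n) → Simplicial (complete n) s
complete-simplicial s u w _ _ u≢w = cong not (⌊≟⌋-≢ u≢w)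

extend-simplicial-new : Symmetric G → G a b ≡ true → Simplicial (extend G a b) zero
extend-simplicial-new {G = G} {a} {b} G-sym a~b (suc u) (suc w) u~0 w~0 su≢sw
  with ∨-true {⌊ u ≟ a ⌋} u~0 | ∨-true {⌊ w ≟ a ⌋} w~0
... | inj₁ u≟a | inj₁ w≟a = ⊥-elim (su≢sw (cong suc (trans (⌊≟⌋-true u≟a) (sym (⌊≟⌋-true w≟a)))))
... | inj₁ u≟a | inj₂ w≟b = subst₂ (Adj G) (sym (⌊≟⌋-true u≟a)) (sym (⌊≟⌋-true w≟b)) a~b
... | inj₂ u≟b | inj₁ w≟a =
  subst₂ (Adj G) (sym (⌊≟⌋-true u≟b)) (sym (⌊≟⌋-true w≟a)) (trans (G-sym b a) a~b)
... | inj₂ u≟b | inj₂ w≟b = ⊥-elim (su≢sw (cong suc (trans (⌊≟⌋-true u≟b) (sym (⌊≟⌋-true w≟b)))))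

extend-simplicial-old : Simplicial G s → s ≢ a → s ≢ b → Simplicial (extend G a b) (suc s)
extend-simplicial-old _ s≢a s≢b zero    _       0~s _   _ = ⊥-elim (Bool.not-¬ (⌊≟⌋-∨-≢ s≢a s≢b) 0~s)
extend-simplicial-old _ s≢a s≢b (suc u) zero    _   0~s _ = ⊥-elim (Bool.not-¬ (⌊≟⌋-∨-≢ s≢a s≢b) 0~s)
extend-simplicial-old simplicial _ _ (suc u) (suc w) u~s w~s su≢sw = simplicial u w u~s w~s (su≢sw ∘ cong suc)

Simplicial-≅ : (σ : G ≅ H) → Simplicial H s → Simplicial G (≅.perm σ ⟨$⟩ˡ s)
Simplicial-≅ {G = G} {H = H} {s = s} (mk≅ π G≐πH) simplicial u w s~u s~w u≢w =
  trans (G≐πH u w) (simplicial _ _ (to-H s~u) (to-H s~w) (u≢w ∘ ⟨$⟩ʳ-injective π))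
  where
  to-H : ∀ {v} → G (π ⟨$⟩ˡ s) v ≡ true → H s (π ⟨$⟩ʳ v) ≡ true
  to-H {v} e = trans (sym (cong (λ t → H t (π ⟨$⟩ʳ v)) (inverseʳ π))) (trans (sym (G≐πH _ v)) e)

record SimplicialTriple (G : Graph n) : Set where
  constructor simplicialTriple
  field
    s₁ s₂ s₃              : Fin n
    s₁≢s₂                 : s₁ ≢ s₂
    s₁≢s₃                 : s₁ ≢ s₃
    s₂≢s₃                 : s₂ ≢ s₃
    s₁≁s₂                 : G s₁ s₂ ≡ false
    s₁≁s₃                 : G s₁ s₃ ≡ false
    s₂≁s₃                 : G s₂ s₃ ≡ false
    simplicial₁           : Simplicial G s₁
    simplicial₂           : Simplicial G s₂
    simplicial₃           : Simplicial G s₃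

SimplicialTriple-≅ : G ≅ H → SimplicialTriple H → SimplicialTriple G
SimplicialTriple-≅ {G = G} {H = H} σ@(mk≅ π G≐πH)
                   (simplicialTriple s₁ s₂ s₃ d₁₂ d₁₃ d₂₃ n₁₂ n₁₃ n₂₃ S₁ S₂ S₃) =
  simplicialTriple (π ⟨$⟩ˡ s₁) (π ⟨$⟩ˡ s₂) (π ⟨$⟩ˡ s₃)
                   (d₁₂ ∘ ⟨$⟩ˡ-injective π) (d₁₃ ∘ ⟨$⟩ˡ-injective π)
                   (d₂₃ ∘ ⟨$⟩ˡ-injective π)
                   (nonadjacent n₁₂) (nonadjacent n₁₃) (nonadjacent n₂₃)
                   (Simplicial-≅ σ S₁) (Simplicial-≅ σ S₂) (Simplicial-≅ σ S₃)
  where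
  nonadjacent : ∀ {x y} → H x y ≡ false → G (π ⟨$⟩ˡ x) (π ⟨$⟩ˡ y) ≡ false
  nonadjacent {x} {y} e = trans (G≐πH _ _) (trans (cong₂ H (inverseʳ π) (inverseʳ π)) e)

SimplicialTriple-extend : Symmetric G → G a b ≡ true → SimplicialTriple G → SimplicialTriple (extend G a b)
SimplicialTriple-extend {G = G} {a = a} {b = b} G-sym a~b
                        (simplicialTriple s₁ s₂ s₃ d₁₂ d₁₃ d₂₃ n₁₂ n₁₃ n₂₃ S₁ S₂ S₃) =
  by-cases (outside? s₁) (outside? s₂) (outside? s₃)
  where
  Outside : Fin _ → Set
  Outside s = s ≢ a × s ≢ b
  Endpoint : Fin _ → Set
  Endpoint s = s ≡ a ⊎ s ≡ b
  outside? : ∀ s → Outside s ⊎ Endpoint s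
  outside? s with s ≟ a | s ≟ b
  ... | yes s≡a | _       = inj₂ (inj₁ s≡a)
  ... | no _    | yes s≡b = inj₂ (inj₂ s≡b)
  ... | no s≢a  | no s≢b  = inj₁ (s≢a , s≢b)
  not-both : ∀ {s t} → s ≢ t → G s t ≡ false → Endpoint s → Endpoint t → ⊥
  not-both s≢t _   (inj₁ refl) (inj₁ refl) = s≢t refl
  not-both _   s≁t (inj₁ refl) (inj₂ refl) = contradiction (trans (sym s≁t) a~b) λ ()
  not-both _   s≁t (inj₂ refl) (inj₁ refl) = contradiction (trans (sym s≁t) (trans (G-sym b a) a~b)) λ ()
  not-both s≢t _   (inj₂ refl) (inj₂ refl) = s≢t refl
  with-new : ∀ {s t} → s ≢ t → G s t ≡ false → Simplicial G s → Simplicial G t → Outside s → Outside t →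
             SimplicialTriple (extend G a b)
  with-new s≢t s≁t Ss St (s≢a , s≢b) (t≢a , t≢b) =
    simplicialTriple zero (suc _) (suc _) (λ ()) (λ ()) (s≢t ∘ Fin.suc-injective)
      (⌊≟⌋-∨-≢ s≢a s≢b) (⌊≟⌋-∨-≢ t≢a t≢b) s≁t
      (extend-simplicial-new G-sym a~b) (extend-simplicial-old Ss s≢a s≢b) (extend-simplicial-old St t≢a t≢b)
  by-cases : Outside s₁ ⊎ Endpoint s₁ → Outside s₂ ⊎ Endpoint s₂ → Outside s₃ ⊎ Endpoint s₃ →
             SimplicialTriple (extend G a b)
  by-cases (inj₁ o₁) (inj₁ o₂) _         = with-new d₁₂ n₁₂ S₁ S₂ o₁ o₂
  by-cases (inj₁ o₁) (inj₂ e₂) (inj₁ o₃) = with-new d₁₃ n₁₃ S₁ S₃ o₁ o₃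
  by-cases (inj₁ _)  (inj₂ e₂) (inj₂ e₃) = ⊥-elim (not-both d₂₃ n₂₃ e₂ e₃)
  by-cases (inj₂ e₁) (inj₁ o₂) (inj₁ o₃) = with-new d₂₃ n₂₃ S₂ S₃ o₂ o₃
  by-cases (inj₂ e₁) (inj₁ _)  (inj₂ e₃) = ⊥-elim (not-both d₁₃ n₁₃ e₁ e₃)
  by-cases (inj₂ e₁) (inj₂ e₂) _         = ⊥-elim (not-both d₁₂ n₁₂ e₁ e₂)

-- Two-paths

-- The graph is core with one vertex attached on the edge x₁y₁ (vertex 0) and one on x₂y₂
-- (vertex 1).  The tree counts of the intermediate graphs are recorded because the counts
-- after attaching a vertex on the edge from vertex 0 to x₁ are computed from them.
record TwoPath (k : ℕ) : Set where
  field
    core           : Graph (2 + k)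
    x₁ y₁ x₂ y₂    : Fin (2 + k)
    core-symmetric : Symmetric core
    edge₁          : core x₁ y₁ ≡ true
    edge₂          : core x₂ y₂ ≡ true
    x₁≢y₁          : x₁ ≢ y₁
    x₂≢y₂          : x₂ ≢ y₂
    trees-core     : HasCount (Trees core) (fib (2 * (1 + k)))
    trees₁         : HasCount (Trees (extend core x₁ y₁)) (fib (2 * (2 + k)))
    trees₂         : HasCount (Trees (extend core x₂ y₂)) (fib (2 * (2 + k)))
    trees          : HasCount (Trees (extend₂ core x₁ y₁ x₂ y₂)) (fib (2 * (3 + k)))

  graph : Graph (4 + k)
  graph = extend₂ core x₁ y₁ x₂ y₂

  graph-symmetric : Symmetric graph
  graph-symmetric = extend-symmetric (extend-symmetric core-symmetric)

  simplicial₀ : Simplicial graph 0F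
  simplicial₀ = extend-simplicial-new (extend-symmetric core-symmetric) edge₁

  simplicial₁ : Simplicial graph 1F
  simplicial₁ = extend-simplicial-old (extend-simplicial-new core-symmetric edge₂) (λ ()) (λ ())

open TwoPath using (graph)

IsTwoPath : (k : ℕ) → Graph (4 + k) → Set
IsTwoPath k G = Σ[ P ∈ TwoPath k ] G ≅ graph P

IsTwoPath-≅ : G ≅ H → IsTwoPath k H → IsTwoPath k G
IsTwoPath-≅ σ (P , τ) = P , ≅-trans σ τ

swapEnds : TwoPath k → TwoPath k
swapEnds P = record P
  { x₁ = x₂ ; y₁ = y₂ ; x₂ = x₁ ; y₂ = y₁
  ; edge₁ = edge₂ ; edge₂ = edge₁ ; x₁≢y₁ = x₂≢y₂ ; x₂≢y₂ = x₁≢y₁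
  ; trees₁ = trees₂ ; trees₂ = trees₁ ; trees = trees-≅ (extend₂-swap core x₂ y₂ x₁ y₁) trees }
  where open TwoPath P hiding (graph)

swapEdge₁ : TwoPath k → TwoPath k
swapEdge₁ P = record P
  { x₁ = y₁ ; y₁ = x₁ ; edge₁ = trans (core-symmetric y₁ x₁) edge₁ ; x₁≢y₁ = x₁≢y₁ ∘ sym
  ; trees₁ = trees-≅ (≐⇒≅ (extend-comm core y₁ x₁)) trees₁
  ; trees = trees-≅ (≐⇒≅ (extend-comm (extend core x₂ y₂) (suc y₁) (suc x₁))) trees }
  where open TwoPath P hiding (graph)

IsTwoPath-grow : ∀ {k} (P : TwoPath k) → IsTwoPath (suc k) (extend (graph P) zero (suc (suc (TwoPath.x₁ P))))
IsTwoPath-grow {k} P = P′ , σ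
  where
  open TwoPath P hiding (graph)
  σ : extend (graph P) zero (suc (suc x₁)) ≅ extend₂ (extend core x₁ y₁) zero (suc x₁) (suc x₂) (suc y₂)
  σ = extend-≅ (extend₂-swap core x₁ y₁ x₂ y₂)
  P′ : TwoPath (suc k)
  P′ = record
    { core = extend core x₁ y₁ ; x₁ = zero ; y₁ = suc x₁ ; x₂ = suc x₂ ; y₂ = suc y₂
    ; core-symmetric = extend-symmetric core-symmetric
    ; edge₁ = cong (_∨ ⌊ x₁ ≟ y₁ ⌋) (⌊≟⌋-refl x₁) ; edge₂ = edge₂
    ; x₁≢y₁ = λ () ; x₂≢y₂ = x₂≢y₂ ∘ Fin.suc-injective
    ; trees-core = trees₁
    ; trees₁ = trees-extend-extend {j = 1 + k} x₁≢y₁ trees-core trees₁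
    ; trees₂ = trees-≅ (extend₂-swap core x₂ y₂ x₁ y₁) trees
    ; trees = trees-≅ (≅-sym σ) (trees-extend-extend {j = 2 + k} (x₁≢y₁ ∘ Fin.suc-injective) trees₂ trees) }

IsTwoPath-extend-end₀ : ∀ {k} (P : TwoPath k) {b} → graph P 0F b ≡ true → IsTwoPath (suc k) (extend (graph P) 0F b)
IsTwoPath-extend-end₀ P {b = suc j} e with ∨-true {⌊ j ≟ suc (TwoPath.x₁ P) ⌋} e
... | inj₁ j≟x₁ = subst (λ t → IsTwoPath _ (extend (graph P) 0F (suc t))) (sym (⌊≟⌋-true j≟x₁))
                    (IsTwoPath-grow P)
... | inj₂ j≟y₁ = subst (λ t → IsTwoPath _ (extend (graph P) 0F (suc t))) (sym (⌊≟⌋-true j≟y₁))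
                    (IsTwoPath-≅ (≐⇒≅ (extend-resp (extend-comm _ _ _))) (IsTwoPath-grow (swapEdge₁ P)))

IsTwoPath-extend-end₁ : ∀ {k} (P : TwoPath k) {b} → graph P 1F b ≡ true → IsTwoPath (suc k) (extend (graph P) 1F b)
IsTwoPath-extend-end₁ P {b = b} e =
  IsTwoPath-≅ (extend-≅ σ) (IsTwoPath-extend-end₀ (swapEnds P) (trans (sym (≅.≐relabel σ 1F b)) e))
  where
  open TwoPath P hiding (graph)
  σ : graph P ≅ graph (swapEnds P)
  σ = extend₂-swap core x₁ y₁ x₂ y₂

graph-extend : ∀ {k} (P : TwoPath k) {a b} → graph P a b ≡ true →
                IsTwoPath (suc k) (extend (graph P) a b) ⊎ SimplicialTriple (extend (graph P) a b)
graph-extend P {0F}          e = inj₁ (IsTwoPath-extend-end₀ P e)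
graph-extend P {1F}          e = inj₁ (IsTwoPath-extend-end₁ P e)
graph-extend P {suc (suc i)} {0F} e =
  inj₁ (IsTwoPath-≅ (≐⇒≅ (extend-comm _ _ _))
                    (IsTwoPath-extend-end₀ P (trans (TwoPath.graph-symmetric P 0F (suc (suc i))) e)))
graph-extend P {suc (suc i)} {1F} e =
  inj₁ (IsTwoPath-≅ (≐⇒≅ (extend-comm _ _ _))
                    (IsTwoPath-extend-end₁ P (trans (TwoPath.graph-symmetric P 1F (suc (suc i))) e)))
graph-extend P {suc (suc i)} {suc (suc j)} e =
  inj₂ (simplicialTriple 0F 1F 2F (λ ()) (λ ()) (λ ()) refl refl refl
          (extend-simplicial-new (TwoPath.graph-symmetric P) e)
          (extend-simplicial-old (TwoPath.simplicial₀ P) (λ ()) (λ ()))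
          (extend-simplicial-old (TwoPath.simplicial₁ P) (λ ()) (λ ())))

IsTwoPath-extend : IsTwoPath k G → G a b ≡ true → IsTwoPath (suc k) (extend G a b) ⊎ SimplicialTriple (extend G a b)
IsTwoPath-extend (P , σ) a~b =
  Sum.map (IsTwoPath-≅ (extend-≅ σ)) (SimplicialTriple-≅ (extend-≅ σ))
          (graph-extend P (trans (sym (≅.≐relabel σ _ _)) a~b))

_≐?_ : (G H : Graph n) → Dec (G ≐ H)
G ≐? H = all? λ i → all? λ j → G i j Bool.≟ H i j

K₂-tree-unique : SpanningTree K₂ E → E ≐ K₂
K₂-tree-unique {E = E} (spanningTree (simple E-sym irr _) conn _) = entries
  where
  first-step : E ∋ 0F ⇝ 1F → E 0F 1F ≡ true
  first-step (_◅_ {j = 0F} e _) = contradiction (trans (sym e) (irr 0F)) λ ()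
  first-step (_◅_ {j = 1F} e _) = e
  entries : E ≐ K₂
  entries 0F 0F = irr 0F
  entries 0F 1F = first-step (conn 0F 1F)
  entries 1F 0F = trans (E-sym 1F 0F) (first-step (conn 0F 1F))
  entries 1F 1F = irr 1F

trees-K₂ : HasCount (Trees K₂) 1
trees-K₂ =
  HasCount-singleton {y = toMatrix K₂}
    (SpanningTree-resp (λ _ _ → refl) (λ i j → sym (entry-toMatrix K₂ i j)) K₂-tree)
    (λ tree → entry-injective λ i j → trans (K₂-tree-unique tree i j) (sym (entry-toMatrix K₂ i j)))
  where
  K₂-tree : SpanningTree K₂ K₂
  K₂-tree = spanningTree (simple complete-symmetric (λ i → cong not (⌊≟⌋-refl i)) (λ _ _ e → e))
                         (IsConnected-via complete-symmetric λ { 0F → ε ; 1F → refl ◅ ε }) refl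

empty : Graph n
empty _ _ = false

forests-K₂ : HasCount (Forests K₂ 0F 1F) 1
forests-K₂ =
  HasCount-singleton {y = toMatrix empty}
    (SpanningForest-resp (λ _ _ → refl) (λ i j → sym (entry-toMatrix empty i j)) empty-forest)
    (λ forest → entry-injective λ i j → trans (entries forest i j) (sym (entry-toMatrix empty i j)))
  where
  empty-forest : SpanningForest K₂ 0F 1F empty
  empty-forest =
    spanningForest (simple (λ _ _ → refl) (λ _ → refl) λ _ _ ()) (λ { 0F → inj₁ ε ; 1F → inj₂ ε }) refl
  entries : SpanningForest K₂ 0F 1F E → E ≐ empty
  entries forest@(spanningForest (simple E-sym irr _) _ _) = λ where
    0F 0F → irr 0F
    0F 1F → Bool.¬-not (SpanningForest-roots-apart forest)
    1F 0F → trans (E-sym 1F 0F) (Bool.¬-not (SpanningForest-roots-apart forest))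
    1F 1F → irr 1F

triangle≐ : extend K₂ 0F 1F ≐ K₃
triangle≐ = from-yes (extend K₂ 0F 1F ≐? K₃)

extend-triangle≐ : extend (extend K₂ 0F 1F) a b ≐ extend K₃ a b
extend-triangle≐ = extend-resp triangle≐

extend-K₂-≅ : K₂ a b ≡ true → extend K₂ a b ≅ K₃
extend-K₂-≅ {a = 0F} {1F} _ = ≐⇒≅ triangle≐
extend-K₂-≅ {a = 1F} {0F} _ = ≐⇒≅ λ i j → trans (extend-comm K₂ 1F 0F i j) (triangle≐ i j)
extend-K₂-≅ {a = 1F} {1F} ()

-- In each case the permutation of K₃ sends the edge ab to the edge {1, 2}.
extend-K₃-≅ : K₃ a b ≡ true → extend K₃ a b ≅ extend K₃ 1F 2F
extend-K₃-≅ {a = 0F} {1F} _ = extend-≅ (complete-≅ (transpose 1F 2F ∘ₚ transpose 0F 1F))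
extend-K₃-≅ {a = 0F} {2F} _ = extend-≅ (complete-≅ (transpose 0F 1F))
extend-K₃-≅ {a = 1F} {0F} _ = extend-≅ (complete-≅ (transpose 0F 2F))
extend-K₃-≅ {a = 1F} {2F} _ = extend-≅ (complete-≅ id)
extend-K₃-≅ {a = 2F} {0F} _ = extend-≅ (complete-≅ (transpose 0F 2F ∘ₚ transpose 0F 1F))
extend-K₃-≅ {a = 2F} {1F} _ = extend-≅ (complete-≅ (transpose 1F 2F))
extend-K₃-≅ {a = 2F} {2F} ()

diamond : TwoPath 0
diamond = record
  { core = K₂ ; x₁ = 0F ; y₁ = 1F ; x₂ = 0F ; y₂ = 1F
  ; core-symmetric = complete-symmetric ; edge₁ = refl ; edge₂ = refl ; x₁≢y₁ = λ () ; x₂≢y₂ = λ ()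
  ; trees-core = trees-K₂ ; trees₁ = trees-triangle ; trees₂ = trees-triangle
  ; trees = trees-≅ σ (trees-extend-extend {j = 1} (λ ()) trees-K₂ trees-triangle) }
  where
  σ : extend₂ K₂ 0F 1F 0F 1F ≅ extend (extend K₂ 0F 1F) 0F 1F
  σ = ≅-trans {H = extend K₃ 1F 2F} (≐⇒≅ extend-triangle≐)
        (≅-trans {H = extend K₃ 0F 1F} (≅-sym (extend-K₃-≅ {a = 0F} {1F} refl))
                 (≐⇒≅ λ i j → sym (extend-triangle≐ i j)))
  trees-triangle : HasCount (Trees (extend K₂ 0F 1F)) 3
  trees-triangle = Extension.trees-extend K₂ (λ ()) trees-K₂ forests-K₂

-- Shapes of 2-trees

data Shape : (n : ℕ) → Graph n → Set where
  edge     : {G : Graph 2} → G ≅ K₂ → Shape 2 G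
  triangle : {G : Graph 3} → G ≅ K₃ → Shape 3 G
  triple   : {G : Graph n} → SimplicialTriple G → Shape n G
  twoPath  : {G : Graph (4 + k)} → IsTwoPath k G → Shape (4 + k) G

Shape-≅ : G ≅ H → Shape n H → Shape n G
Shape-≅ σ (edge τ)     = edge (≅-trans σ τ)
Shape-≅ σ (triangle τ) = triangle (≅-trans σ τ)
Shape-≅ σ (triple t)   = triple (SimplicialTriple-≅ σ t)
Shape-≅ σ (twoPath p)  = twoPath (IsTwoPath-≅ σ p)

Shape-extend : Symmetric G → G a b ≡ true → Shape n G → Shape (suc n) (extend G a b)
Shape-extend G-sym a~b (edge σ) =
  triangle (≅-trans (extend-≅ σ) (extend-K₂-≅ (trans (sym (≅.≐relabel σ _ _)) a~b)))
Shape-extend G-sym a~b (triangle σ) =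
  twoPath (diamond , ≅-trans (extend-≅ σ) (≅-trans (extend-K₃-≅ (trans (sym (≅.≐relabel σ _ _)) a~b))
                                                  (≐⇒≅ λ i j → sym (extend-triangle≐ i j))))
Shape-extend G-sym a~b (triple t)  = triple (SimplicialTriple-extend G-sym a~b t)
Shape-extend G-sym a~b (twoPath p) = Sum.[ twoPath , triple ]′ (IsTwoPath-extend p a~b)

TwoTree-symmetric : TwoTree n G → Symmetric G
TwoTree-symmetric base          = complete-symmetric
TwoTree-symmetric (add _ _ _ t) = extend-symmetric (TwoTree-symmetric t)
TwoTree-symmetric (iso π t)     = λ i j → TwoTree-symmetric t _ _

shape : TwoTree n G → Shape n G
shape base             = edge (≐⇒≅ λ _ _ → refl)
shape (add a b a~b t)  = Shape-extend (TwoTree-symmetric t) a~b (shape t)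
shape (iso π t)        = Shape-≅ (mk≅ π λ _ _ → refl) (shape t)

SimplicialTriple-¬HasCount₂ : SimplicialTriple G → ¬ HasCount (Simplicial G) 2
SimplicialTriple-¬HasCount₂ (simplicialTriple _ _ _ d₁₂ d₁₃ d₂₃ _ _ _ S₁ S₂ S₃) two =
  HasCount₂-three two S₁ S₂ S₃ d₁₂ d₁₃ d₂₃

triangle-¬HasCount₂ : G ≅ K₃ → ¬ HasCount (Simplicial G) 2
triangle-¬HasCount₂ σ two =
  HasCount₂-three two (simplicial 0F) (simplicial 1F) (simplicial 2F)
                      ((λ ()) ∘ π⁻¹-injective) ((λ ()) ∘ π⁻¹-injective) ((λ ()) ∘ π⁻¹-injective)
  where
  simplicial : ∀ s → Simplicial _ (≅.perm σ ⟨$⟩ˡ s)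
  simplicial s = Simplicial-≅ σ (complete-simplicial s)
  π⁻¹-injective : ∀ {s t} → ≅.perm σ ⟨$⟩ˡ s ≡ ≅.perm σ ⟨$⟩ˡ t → s ≡ t
  π⁻¹-injective = ⟨$⟩ˡ-injective (≅.perm σ)

corollary3p6 : (n : ℕ) → 2 ≤ n → (G : Graph n) → TwoTree n G →
    HasCount (Simplicial G) 2 →
    HasCount (IsSpanningTree G) (fib (2 * n ∸ 2))
corollary3p6 n _ G two-tree two-simplicial =
  HasCount-⇔ (λ _ → ⇔-sym IsSpanningTree⇔Trees) (trees-count (shape two-tree))
  where
  trees-count : Shape n G → HasCount (Trees G) (fib (2 * n ∸ 2))
  trees-count (edge σ)              = trees-≅ σ trees-K₂
  trees-count (triangle σ)          = ⊥-elim (triangle-¬HasCount₂ σ two-simplicial)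
  trees-count (triple t)            = ⊥-elim (SimplicialTriple-¬HasCount₂ t two-simplicial)
  trees-count (twoPath {k} (P , σ)) =
    subst (HasCount (Trees G)) (cong (λ i → fib (i ∸ 2)) (sym (*-suc 2 (3 + k)))) (trees-≅ σ (TwoPath.trees P))
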